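{- Let $k\ge2$, $\ell\in\mathbb{N}$, let $A\subset\Sigma_k^\ell\setminus\{\mathtt 0^\ell\}$ and $a=a_A$. Then the sequence $h\colon\mathbb{N}_0\to\{+1,-1\}$ given by $h(n)=a(n)/a(\lfloor n/k\rfloor)$ is periodic with period $k^\ell$.
   Context: $\Sigma_k=\{\mathtt 0,\dots,k-1\}$; $(n)_k$ is the base-$k$ expansion of $n$ without leading zeros; for a word $v$ not of the form $\mathtt 0^j$, $\#(v,n)$ is the number of pairs of words $(x,y)$ with $\mathtt 0^{|v|-1}(n)_k=xvy$; $a_A(n)=(-1)^{\sum_{v\in A}\#(v,n)}$. -}

module Defs where

open import Data.Nat using (ℕ; zero; suc; _+_; _*_; _∸_; NonZero)
open import Data.Nat.DivMod using (_/_; _mod_)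
open import Data.Fin using (Fin)
open import Data.Fin.Properties using (_≟_)
open import Data.Bool using (Bool; true; false; _∧_; if_then_else_)
open import Data.List using (List; []; _∷_; _++_; [_]; replicate; map)
open import Data.Nat.ListAction using (sum)
open import Data.Vec using (Vec; toList)
open import Data.Integer using (ℤ; -_) renaming (_*_ to _*ℤ_)
open import Data.Integer using () renaming (+_ to pos)
open import Relation.Nullary.Decidable using (⌊_⌋)

module _ (k : ℕ) .{{_ : NonZero k}} where

  -- base-k digits, most significant first, no leading zeros; (0)_k = empty word.
  -- Uses fuel n, which suffices for k ≥ 2 (n has at most n digits).
  digitsAux : ℕ → ℕ → List (Fin k)
  digitsAux zero    _       = []
  digitsAux (suc f) zero    = []
  digitsAux (suc f) (suc m) = digitsAux f (suc m / k) ++ [ suc m mod k ]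

  digits : ℕ → List (Fin k)
  digits n = digitsAux n n

  zeroDigit : Fin k
  zeroDigit = 0 mod k

  isPrefix : List (Fin k) → List (Fin k) → Bool
  isPrefix []       _        = true
  isPrefix (_ ∷ _)  []       = false
  isPrefix (a ∷ as) (b ∷ bs) = ⌊ a ≟ b ⌋ ∧ isPrefix as bs

  occ : List (Fin k) → List (Fin k) → ℕ
  occ v []       = if isPrefix v [] then 1 else 0
  occ v (c ∷ cs) = (if isPrefix v (c ∷ cs) then 1 else 0) + occ v cs

  count# : {ℓ : ℕ} → Vec (Fin k) ℓ → ℕ → ℕ
  count# {ℓ} v n = occ (toList v) (replicate (ℓ ∸ 1) zeroDigit ++ digits n)

  negOnePow : ℕ → ℤ
  negOnePow zero    = pos 1
  negOnePow (suc m) = - negOnePow m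

  -- a_A(n) = (-1)^(Σ_{v ∈ A} #(v , n)), A given as a duplicate-free list
  aSeq : {ℓ : ℕ} → List (Vec (Fin k) ℓ) → ℕ → ℤ
  aSeq A n = negOnePow (sum (map (λ v → count# v n) A))

  -- h(n) = a(n) / a(⌊n/k⌋); since a takes values ±1, the quotient equals the product
  hSeq : {ℓ : ℕ} → List (Vec (Fin k) ℓ) → ℕ → ℤ
  hSeq A n = aSeq A n *ℤ aSeq A (n / k)

module Submission where

-- Write ℓ = p + 1 and call window ℓ n the last ℓ base-k digits of n, padded
-- with leading zeros (so window ℓ n is the length-ℓ suffix of 0^p (n)_k).
-- For k ≥ 2 and n > 0 we have (n)_k = (⌊n/k⌋)_k c with c the last digit, so
-- the word 0^p (n)_k is 0^p (⌊n/k⌋)_k extended by the single letter c.  An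
-- occurrence of a word v of length ℓ in the extended word either lies in
-- 0^p (⌊n/k⌋)_k or is its new suffix window ℓ n; this gives
--     #(v , n) = #(v , ⌊n/k⌋) + [v = window ℓ n]
-- (for n = 0 the indicator vanishes, since window ℓ 0 = 0^ℓ and v ≠ 0^ℓ).
-- Summing over v ∈ A and using (-1)^(X+Y) (-1)^X = (-1)^Y shows that
-- h(n) = (-1)^(number of v ∈ A equal to window ℓ n), which depends on n only
-- through window ℓ n; and window ℓ (n + k^ℓ) = window ℓ n.  When ℓ = 0 the
-- set A is empty and there is nothing to prove.

open import Defs
open import Data.Nat using (ℕ; zero; suc; _+_; _*_; _^_; _≤_; _<_; s≤s; s≤s⁻¹; NonZero)
open import Data.Nat.Properties
  using (≤-refl; ≤-reflexive; ≤-trans; <⇒≤; n<1+n; m≤n+m; +-comm; +-assoc; +-identityʳ; *-comm; n≤0⇒n≡0; +-commutativeSemigroup)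
open import Algebra.Properties.CommutativeSemigroup +-commutativeSemigroup using (interchange)
open import Data.Nat.DivMod using (_/_; _mod_; 0/n≡0; m/n<m; m%n≤m; m*n/n≡m; +-distrib-/-∣ʳ; [m+kn]%n≡m%n)
open import Data.Nat.Divisibility using (divides)
open import Data.Nat.ListAction using (sum)
open import Data.Bool using (Bool; true; false; _∧_; if_then_else_)
open import Data.Bool.Properties using (∧-zeroʳ)
open import Data.Fin using (Fin; toℕ)
open import Data.Fin.Properties using (_≟_; toℕ-fromℕ<; fromℕ<-cong)
open import Data.List using (List; []; _∷_; _++_; [_]; replicate; length; map)
open import Data.List.Properties using (++-assoc; ++-identityʳ; length-++)
open import Data.List.Relation.Unary.All using () renaming (All to AllL)
import Data.List.Relation.Unary.All as ListAll
open import Data.List.Relation.Unary.Unique.Propositional using (Unique)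
open import Data.Vec using (Vec; toList)
open import Data.Vec.Properties using (length-toList)
open import Data.Vec.Relation.Unary.All using (All)
import Data.Vec.Relation.Unary.All as VecAll
open import Data.Integer using (-_) renaming (_*_ to _*ℤ_)
open import Data.Integer.Properties using (*-identityʳ; neg-distribˡ-*; neg-distribʳ-*; neg-involutive)
open import Data.Product using (∃; _,_)
open import Function using (_∘_)
open import Data.Empty using (⊥-elim)
open import Relation.Nullary using (¬_; yes; no)
open import Relation.Nullary.Decidable using (⌊_⌋)
open import Relation.Binary.PropositionalEquality
  using (_≡_; refl; sym; trans; cong; cong₂; subst₂; module ≡-Reasoning)
open ≡-Reasoning

indicator : Bool → ℕ
indicator b = if b then 1 else 0

replicate-snoc : ∀ {a} {X : Set a} p (x : X) → replicate p x ++ [ x ] ≡ replicate (suc p) x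
replicate-snoc zero    x = refl
replicate-snoc (suc p) x = cong (x ∷_) (replicate-snoc p x)

sum-map-split : ∀ {a} {X : Set a} (f g h : X → ℕ) {xs : List X} →
                AllL (λ x → f x ≡ g x + h x) xs →
                sum (map f xs) ≡ sum (map g xs) + sum (map h xs)
sum-map-split f g h {[]}     ListAll.[]       = refl
sum-map-split f g h {x ∷ xs} (fx ListAll.∷ fxs) = begin
  f x + sum (map f xs)                             ≡⟨ cong₂ _+_ fx (sum-map-split f g h fxs) ⟩
  (g x + h x) + (sum (map g xs) + sum (map h xs))  ≡⟨ interchange (g x) (h x) _ _ ⟩
  (g x + sum (map g xs)) + (h x + sum (map h xs))  ∎

neg-*-neg : ∀ a b → (- a) *ℤ (- b) ≡ a *ℤ b
neg-*-neg a b = begin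
  (- a) *ℤ (- b)   ≡⟨ neg-distribˡ-* a (- b) ⟨
  - (a *ℤ (- b))   ≡⟨ cong -_ (neg-distribʳ-* a b) ⟨
  - (- (a *ℤ b))   ≡⟨ neg-involutive (a *ℤ b) ⟩
  a *ℤ b           ∎

module _ (k : ℕ) .{{_ : NonZero k}} where

  negOnePow-cancel : ∀ X Y → negOnePow k (X + Y) *ℤ negOnePow k X ≡ negOnePow k Y
  negOnePow-cancel zero    Y = *-identityʳ (negOnePow k Y)
  negOnePow-cancel (suc X) Y =
    trans (neg-*-neg (negOnePow k (X + Y)) (negOnePow k X)) (negOnePow-cancel X Y)

  isPrefix-++ : ∀ v u r → length v ≤ length u → isPrefix k v (u ++ r) ≡ isPrefix k v u
  isPrefix-++ []       u        r _       = refl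
  isPrefix-++ (a ∷ as) (b ∷ bs) r (s≤s l) = cong (⌊ a ≟ b ⌋ ∧_) (isPrefix-++ as bs r l)

  isPrefix-short : ∀ v u → length u < length v → isPrefix k v u ≡ false
  isPrefix-short (a ∷ as) []       _       = refl
  isPrefix-short (a ∷ as) (b ∷ bs) (s≤s l) = trans (cong (⌊ a ≟ b ⌋ ∧_) (isPrefix-short as bs l)) (∧-zeroʳ _)

  occ-short : ∀ v u → length u ≤ length v → occ k v u ≡ indicator (isPrefix k v u)
  occ-short v []       _ = refl
  occ-short v (c ∷ cs) l = begin
    indicator (isPrefix k v (c ∷ cs)) + occ k v cs                     ≡⟨ cong (indicator (isPrefix k v (c ∷ cs)) +_) no-later ⟩
    indicator (isPrefix k v (c ∷ cs)) + 0                              ≡⟨ +-identityʳ _ ⟩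
    indicator (isPrefix k v (c ∷ cs))                                  ∎
    where
      no-later : occ k v cs ≡ 0
      no-later = trans (occ-short v cs (<⇒≤ l)) (cong indicator (isPrefix-short v cs l))

  -- Appending a letter c to a word q ++ t with |t| + 1 = |v| creates exactly
  -- one new candidate occurrence of v, namely the suffix t ++ [ c ].
  occ-snoc : ∀ {p} v q t c → length v ≡ suc p → length t ≡ p →
             occ k v (q ++ t ++ [ c ]) ≡ occ k v (q ++ t) + indicator (isPrefix k v (t ++ [ c ]))
  occ-snoc {p} v [] t c |v| |t| = begin
    occ k v (t ++ [ c ])                                 ≡⟨ occ-short v (t ++ [ c ]) (≤-reflexive same-length) ⟩
    indicator (isPrefix k v (t ++ [ c ]))                ≡⟨ cong (_+ indicator (isPrefix k v (t ++ [ c ]))) t-has-none ⟨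
    occ k v t + indicator (isPrefix k v (t ++ [ c ]))    ∎
    where
      same-length : length (t ++ [ c ]) ≡ length v
      same-length = trans (length-++ t) (trans (+-comm (length t) 1) (trans (cong suc |t|) (sym |v|)))
      t<v : length t < length v
      t<v = subst₂ _<_ (sym |t|) (sym |v|) (n<1+n p)
      t-has-none : occ k v t ≡ 0
      t-has-none = trans (occ-short v t (<⇒≤ t<v)) (cong indicator (isPrefix-short v t t<v))
  occ-snoc {p} v (x ∷ q) t c |v| |t| = begin
    indicator (isPrefix k v (x ∷ q ++ t ++ [ c ])) + occ k v (q ++ t ++ [ c ])
      ≡⟨ cong₂ _+_ (cong (λ w → indicator (isPrefix k v (x ∷ w))) (sym (++-assoc q t [ c ])))
                   (occ-snoc v q t c |v| |t|) ⟩
    indicator (isPrefix k v ((x ∷ q ++ t) ++ [ c ])) + (occ k v (q ++ t) + new)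
      ≡⟨ cong (λ b → indicator b + (occ k v (q ++ t) + new)) (isPrefix-++ v (x ∷ q ++ t) [ c ] long-enough) ⟩
    indicator (isPrefix k v (x ∷ q ++ t)) + (occ k v (q ++ t) + new)
      ≡⟨ +-assoc (indicator (isPrefix k v (x ∷ q ++ t))) _ _ ⟨
    occ k v (x ∷ q ++ t) + new
      ∎
    where
      new : ℕ
      new = indicator (isPrefix k v (t ++ [ c ]))
      long-enough : length v ≤ length (x ∷ q ++ t)
      long-enough rewrite |v| | length-++ q {t} | |t| = s≤s (m≤n+m p (length q))

  toℕ-zeroDigit : toℕ (zeroDigit k) ≡ 0
  toℕ-zeroDigit = trans (toℕ-fromℕ< _) (n≤0⇒n≡0 (m%n≤m 0 k))

  prefix-of-zeros : ∀ {ℓ} (v : Vec (Fin k) ℓ) →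
                    isPrefix k (toList v) (replicate ℓ (zeroDigit k)) ≡ true → All (λ d → toℕ d ≡ 0) v
  prefix-of-zeros Vec.[]       _ = VecAll.[]
  prefix-of-zeros (a Vec.∷ v) e with a ≟ zeroDigit k
  ... | yes refl = toℕ-zeroDigit VecAll.∷ prefix-of-zeros v e
  ... | no _ with () ← e

  nonzero-not-prefix-of-zeros : ∀ {ℓ} (v : Vec (Fin k) ℓ) → ¬ All (λ d → toℕ d ≡ 0) v →
                                isPrefix k (toList v) (replicate ℓ (zeroDigit k)) ≡ false
  nonzero-not-prefix-of-zeros {ℓ} v v≢0 with isPrefix k (toList v) (replicate ℓ (zeroDigit k)) in e
  ... | true  = ⊥-elim (v≢0 (prefix-of-zeros v e))
  ... | false = refl

  window : ℕ → ℕ → List (Fin k)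
  window zero    n = []
  window (suc p) n = window p (n / k) ++ [ n mod k ]

  window-length : ∀ p n → length (window p n) ≡ p
  window-length zero    n = refl
  window-length (suc p) n = trans (length-++ (window p (n / k))) (trans (cong (_+ 1) (window-length p (n / k))) (+-comm p 1))

  window-zero : ∀ p → window p 0 ≡ replicate p (zeroDigit k)
  window-zero zero    = refl
  window-zero (suc p) = begin
    window p (0 / k) ++ [ zeroDigit k ]          ≡⟨ cong (λ m → window p m ++ [ zeroDigit k ]) (0/n≡0 k) ⟩
    window p 0 ++ [ zeroDigit k ]                ≡⟨ cong (_++ [ zeroDigit k ]) (window-zero p) ⟩
    replicate p (zeroDigit k) ++ [ zeroDigit k ] ≡⟨ replicate-snoc p (zeroDigit k) ⟩
    replicate (suc p) (zeroDigit k)              ∎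

  window-periodic : ∀ p n → window p (n + k ^ p) ≡ window p n
  window-periodic zero    n = refl
  window-periodic (suc p) n rewrite *-comm k (k ^ p) = cong₂ _++_ higher-digits (cong [_] last-digit)
    where
      quotient : (n + k ^ p * k) / k ≡ n / k + k ^ p
      quotient = trans (+-distrib-/-∣ʳ n (divides (k ^ p) refl)) (cong (n / k +_) (m*n/n≡m (k ^ p) k))
      higher-digits : window p ((n + k ^ p * k) / k) ≡ window p (n / k)
      higher-digits = trans (cong (window p) quotient) (window-periodic p (n / k))
      last-digit : (n + k ^ p * k) mod k ≡ n mod k
      last-digit = fromℕ<-cong _ _ ([m+kn]%n≡m%n n (k ^ p) k) _ _

  -- The number of words of A that are prefixes of w (for |w| = ℓ: equal to w).
  matches : ∀ {ℓ} → List (Vec (Fin k) ℓ) → List (Fin k) → ℕ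
  matches A w = sum (map (λ v → indicator (isPrefix k (toList v) w)) A)

  module _ (2≤k : 2 ≤ k) where

    /k-decreasing : ∀ m → suc m / k ≤ m
    /k-decreasing m = s≤s⁻¹ (m/n<m (suc m) k 2≤k)

    digitsAux-fuel : ∀ f g x → x ≤ f → x ≤ g → digitsAux k f x ≡ digitsAux k g x
    digitsAux-fuel zero    zero    x       _       _       = refl
    digitsAux-fuel zero    (suc g) zero    _       _       = refl
    digitsAux-fuel (suc f) zero    zero    _       _       = refl
    digitsAux-fuel (suc f) (suc g) zero    _       _       = refl
    digitsAux-fuel (suc f) (suc g) (suc m) (s≤s x≤f) (s≤s x≤g) =
      cong (_++ [ suc m mod k ])
           (digitsAux-fuel f g (suc m / k) (≤-trans (/k-decreasing m) x≤f) (≤-trans (/k-decreasing m) x≤g))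

    digits-snoc : ∀ m → digits k (suc m) ≡ digits k (suc m / k) ++ [ suc m mod k ]
    digits-snoc m = cong (_++ [ suc m mod k ]) (digitsAux-fuel m (suc m / k) (suc m / k) (/k-decreasing m) ≤-refl)

    padded-ends-with-window : ∀ p m → ∃ λ q → replicate p (zeroDigit k) ++ digits k m ≡ q ++ window p m
    padded-ends-with-window p       zero    = [] , trans (++-identityʳ _) (sym (window-zero p))
    padded-ends-with-window zero    (suc m) = digits k (suc m) , sym (++-identityʳ _)
    padded-ends-with-window (suc p) (suc m) with padded-ends-with-window p (suc m / k)
    ... | q , split = zeroDigit k ∷ q , cong (zeroDigit k ∷_) (begin
      zeros ++ digits k (suc m)                       ≡⟨ cong (zeros ++_) (digits-snoc m) ⟩
      zeros ++ (digits k (suc m / k) ++ [ c ])        ≡⟨ ++-assoc zeros _ _ ⟨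
      (zeros ++ digits k (suc m / k)) ++ [ c ]        ≡⟨ cong (_++ [ c ]) split ⟩
      (q ++ window p (suc m / k)) ++ [ c ]            ≡⟨ ++-assoc q _ _ ⟩
      q ++ window (suc p) (suc m)                     ∎)
      where
        zeros : List (Fin k)
        zeros = replicate p (zeroDigit k)
        c : Fin k
        c = suc m mod k

    count-step : ∀ {p} (v : Vec (Fin k) (suc p)) → ¬ All (λ d → toℕ d ≡ 0) v → ∀ n →
                 count# k v n ≡ count# k v (n / k) + indicator (isPrefix k (toList v) (window (suc p) n))
    count-step {p} v v≢0 zero = begin
      count# k v 0                                 ≡⟨ cong (count# k v) (0/n≡0 k) ⟨
      count# k v (0 / k)                           ≡⟨ +-identityʳ _ ⟨
      count# k v (0 / k) + indicator false         ≡⟨ cong (λ b → count# k v (0 / k) + indicator b) no-match ⟨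
      count# k v (0 / k) + indicator (isPrefix k (toList v) (window (suc p) 0)) ∎
      where
        no-match : isPrefix k (toList v) (window (suc p) 0) ≡ false
        no-match = trans (cong (isPrefix k (toList v)) (window-zero (suc p))) (nonzero-not-prefix-of-zeros v v≢0)
    count-step {p} v v≢0 (suc m) with padded-ends-with-window p (suc m / k)
    ... | q , split = begin
      occ k w (zeros ++ digits k (suc m))                ≡⟨ cong (λ d → occ k w (zeros ++ d)) (digits-snoc m) ⟩
      occ k w (zeros ++ (digits k (suc m / k) ++ [ c ])) ≡⟨ cong (occ k w) (++-assoc zeros _ _) ⟨
      occ k w ((zeros ++ digits k (suc m / k)) ++ [ c ]) ≡⟨ cong (λ x → occ k w (x ++ [ c ])) split ⟩
      occ k w ((q ++ t) ++ [ c ])                        ≡⟨ cong (occ k w) (++-assoc q t [ c ]) ⟩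
      occ k w (q ++ t ++ [ c ])                          ≡⟨ occ-snoc w q t c (length-toList v) (window-length p (suc m / k)) ⟩
      occ k w (q ++ t) + indicator (isPrefix k w (t ++ [ c ]))
        ≡⟨ cong (λ x → occ k w x + indicator (isPrefix k w (t ++ [ c ]))) split ⟨
      count# k v (suc m / k) + indicator (isPrefix k w (window (suc p) (suc m))) ∎
      where
        w : List (Fin k)
        w = toList v
        zeros : List (Fin k)
        zeros = replicate p (zeroDigit k)
        c : Fin k
        c = suc m mod k
        t : List (Fin k)
        t = window p (suc m / k)

    hSeq-window : ∀ {p} (A : List (Vec (Fin k) (suc p))) → AllL (λ v → ¬ All (λ d → toℕ d ≡ 0) v) A →
                  ∀ n → hSeq k A n ≡ negOnePow k (matches A (window (suc p) n))
    hSeq-window {p} A nonzero n = begin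
      negOnePow k (sum (map (λ v → count# k v n) A)) *ℤ negOnePow k below
        ≡⟨ cong (λ X → negOnePow k X *ℤ negOnePow k below) counts-split ⟩
      negOnePow k (below + matches A (window (suc p) n)) *ℤ negOnePow k below
        ≡⟨ negOnePow-cancel below (matches A (window (suc p) n)) ⟩
      negOnePow k (matches A (window (suc p) n)) ∎
      where
        below : ℕ
        below = sum (map (λ v → count# k v (n / k)) A)
        counts-split : sum (map (λ v → count# k v n) A) ≡ below + matches A (window (suc p) n)
        counts-split = sum-map-split _ _ _ (ListAll.map (λ {v} v≢0 → count-step v v≢0 n) nonzero)

-- Lemma 4.3: h is periodic with period k^ℓ.  For ℓ = 0 the list A is empty,
-- since the empty word is the zero word; otherwise h(n) depends only on window ℓ n.
lemma4p3 : (k : ℕ) .{{_ : NonZero k}} → 2 ≤ k → (ℓ : ℕ)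
    → (A : List (Vec (Fin k) ℓ)) → Unique A
    → AllL (λ v → ¬ All (λ d → toℕ d ≡ 0) v) A
    → ∀ (n : ℕ) → hSeq k A (n + k ^ ℓ) ≡ hSeq k A n
lemma4p3 k 2≤k zero    []           _ _                  n = refl
lemma4p3 k 2≤k zero    (Vec.[] ∷ _) _ ([]≢0 ListAll.∷ _) n = ⊥-elim ([]≢0 VecAll.[])
lemma4p3 k 2≤k (suc p) A            _ nonzero            n = begin
  hSeq k A (n + k ^ suc p)
    ≡⟨ hSeq-window k 2≤k A nonzero (n + k ^ suc p) ⟩
  negOnePow k (matches k A (window k (suc p) (n + k ^ suc p)))
    ≡⟨ cong (negOnePow k ∘ matches k A) (window-periodic k (suc p) n) ⟩
  negOnePow k (matches k A (window k (suc p) n))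
    ≡⟨ hSeq-window k 2≤k A nonzero n ⟨
  hSeq k A n
    ∎
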